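{- Let $k\geq 2$, let $H$ be a $k$-graph and let $S$ be a vertex cover of $H$. Then there exist a subgraph $H'\subseteq H$ and a subset $S'\subseteq S$ such that $|H'|\geq \frac{k}{2^k}|H|$ and $S'$ is a cross-cut of $H'$.
   Context: A $k$-graph is a $k$-uniform hypergraph; $|H|$ denotes its number of edges. A vertex cover of $H$ is a set of vertices meeting every edge of $H$. A cross-cut of a hypergraph $H'$ is a set of vertices containing exactly one vertex of each edge of $H'$. -}

module Defs where

open import Data.Nat using (ℕ)
open import Data.Fin.Subset using (Subset; ∣_∣; _∩_; Nonempty)
open import Data.List using (List)
open import Data.List.Relation.Unary.All using (All)
open import Data.List.Relation.Unary.Unique.Propositional using (Unique)
open import Relation.Binary.PropositionalEquality using (_≡_)
open import Data.Product using (_×_)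

record KGraph (k n : ℕ) : Set where
  field
    edges   : List (Subset n)
    unique  : Unique edges
    uniform : All (λ e → ∣ e ∣ ≡ k) edges

open KGraph public

open import Data.List using (length)
size : ∀ {k n} → KGraph k n → ℕ
size H = length (edges H)

IsVertexCover : ∀ {k n} → KGraph k n → Subset n → Set
IsVertexCover H S = All (λ e → Nonempty (e ∩ S)) (edges H)

IsCrossCut : ∀ {k n} → KGraph k n → Subset n → Set
IsCrossCut H S = All (λ e → ∣ e ∩ S ∣ ≡ 1) (edges H)

open import Data.List.Membership.Propositional using (_∈_)
_⊆ᴴ_ : ∀ {k n} → KGraph k n → KGraph k n → Set
H' ⊆ᴴ H = ∀ {e} → e ∈ edges H' → e ∈ edges H

-- Choose T ⊆ Fin n uniformly at random and put S' = S ∩ T. An edge e meeting S in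
-- p ≥ 1 vertices is cut exactly once by S' for p · 2ⁿ⁻ᵖ of the 2ⁿ choices of T,
-- and p / 2ᵖ ≥ k / 2ᵏ for 1 ≤ p ≤ k. Hence the expected number of edges cut
-- exactly once by S' is at least (k / 2ᵏ) |H|, and some T attains the average.
module Submission where

open import Defs
open import Data.Bool using (Bool; true; false)
open import Data.Fin.Subset using (Subset; _⊆_; _∩_; ∣_∣; Nonempty; inside; outside)
open import Data.Fin.Subset.Properties using (p∩q⊆p; ∣p∩q∣≤∣p∣; ∩-assoc; x∈p⇒∣p-x∣<∣p∣)
open import Data.List using (List; []; _∷_; length; filter)
open import Data.List.Membership.Propositional.Properties using (∈-filter⁻)
open import Data.List.Relation.Unary.All using (All; []; _∷_)
import Data.List.Relation.Unary.All.Properties as All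
import Data.List.Relation.Unary.Unique.Propositional.Properties as Unique
open import Data.Nat using (ℕ; zero; suc; _≤_; _+_; _*_; _^_; _≟_; z≤n; s≤s)
open import Data.Nat.Combinatorics using (_C_; nC1≡n; nCk+nC[k+1]≡[n+1]C[k+1])
open import Data.Nat.Properties
open import Algebra.Properties.CommutativeSemigroup +-commutativeSemigroup using (interchange)
open import Data.Nat.Tactic.RingSolver using (solve-∀)
open import Data.Product using (Σ; _×_; _,_; proj₁; proj₂; ∃-syntax)
open import Data.Sum using (inj₁; inj₂)
open import Data.Vec using ([]; _∷_)
open import Function using (_∘_)
open import Level using (Level)
open import Relation.Binary.PropositionalEquality
open import Relation.Nullary using (does)
open import Relation.Unary using (Pred; Decidable)

private
  variable
    a p : Level
    A : Set a

m+n≤2*o : ∀ {m n o} → m ≤ o → n ≤ o → m + n ≤ 2 * o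
m+n≤2*o {o = o} m≤o n≤o =
  ≤-trans (+-mono-≤ m≤o n≤o) (≤-reflexive (cong (o +_) (sym (+-identityʳ o))))

k*2^j≤j*2^k : ∀ {j} k → 1 ≤ j → j ≤ k → k * 2 ^ j ≤ j * 2 ^ k
k*2^j≤j*2^k k 1≤j j≤k with m≤n⇒m<n∨m≡n j≤k
... | inj₂ refl = ≤-refl
k*2^j≤j*2^k {j} (suc k) 1≤j _ | inj₁ (s≤s j≤k) = begin
  suc k * 2 ^ j     ≤⟨ *-monoˡ-≤ (2 ^ j) (m+n≤2*o (≤-trans 1≤j j≤k) ≤-refl) ⟩
  2 * k * 2 ^ j     ≡⟨ *-assoc 2 k (2 ^ j) ⟩
  2 * (k * 2 ^ j)   ≤⟨ *-monoʳ-≤ 2 (k*2^j≤j*2^k k 1≤j j≤k) ⟩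
  2 * (j * 2 ^ k)   ≡⟨ 2*[x*y]≡x*[2*y] j (2 ^ k) ⟩
  j * (2 * 2 ^ k)   ∎
  where
  open ≤-Reasoning
  2*[x*y]≡x*[2*y] : ∀ x y → 2 * (x * y) ≡ x * (2 * y)
  2*[x*y]≡x*[2*y] = solve-∀

𝟙 : Bool → ℕ
𝟙 true  = 1
𝟙 false = 0

length-filter-∷ : {P : Pred A p} (P? : Decidable P) (x : A) (xs : List A) →
                  length (filter P? (x ∷ xs)) ≡ 𝟙 (does (P? x)) + length (filter P? xs)
length-filter-∷ P? x xs with does (P? x)
... | true  = refl
... | false = refl

Σ-subsets : ∀ n → (Subset n → ℕ) → ℕ
Σ-subsets zero    f = f []
Σ-subsets (suc n) f = Σ-subsets n (f ∘ (outside ∷_)) + Σ-subsets n (f ∘ (inside ∷_))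

Σ-subsets-cong : ∀ n {f g : Subset n → ℕ} → (∀ T → f T ≡ g T) → Σ-subsets n f ≡ Σ-subsets n g
Σ-subsets-cong zero    f≗g = f≗g []
Σ-subsets-cong (suc n) f≗g =
  cong₂ _+_ (Σ-subsets-cong n (f≗g ∘ (outside ∷_))) (Σ-subsets-cong n (f≗g ∘ (inside ∷_)))

Σ-subsets-0 : ∀ n → Σ-subsets n (λ _ → 0) ≡ 0
Σ-subsets-0 zero    = refl
Σ-subsets-0 (suc n) = cong₂ _+_ (Σ-subsets-0 n) (Σ-subsets-0 n)

Σ-subsets-+ : ∀ n (f g : Subset n → ℕ) →
              Σ-subsets n (λ T → f T + g T) ≡ Σ-subsets n f + Σ-subsets n g
Σ-subsets-+ zero    f g = refl
Σ-subsets-+ (suc n) f g =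
  trans (cong₂ _+_ (Σ-subsets-+ n (f ∘ (outside ∷_)) (g ∘ (outside ∷_)))
                   (Σ-subsets-+ n (f ∘ (inside ∷_)) (g ∘ (inside ∷_))))
        (interchange (Σ-subsets n (f ∘ (outside ∷_))) _ _ _)

Σ-subsets-average : ∀ n (f : Subset n → ℕ) → ∃[ T ] Σ-subsets n f ≤ 2 ^ n * f T
Σ-subsets-average zero    f = [] , ≤-reflexive (sym (*-identityˡ (f [])))
Σ-subsets-average (suc n) f
  with T₀ , Σ₀≤ ← Σ-subsets-average n (f ∘ (outside ∷_))
     | T₁ , Σ₁≤ ← Σ-subsets-average n (f ∘ (inside ∷_))
  with ≤-total (f (outside ∷ T₀)) (f (inside ∷ T₁))
... | inj₁ f₀≤f₁ = inside ∷ T₁ ,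
  ≤-trans (m+n≤2*o (≤-trans Σ₀≤ (*-monoʳ-≤ (2 ^ n) f₀≤f₁)) Σ₁≤)
          (≤-reflexive (sym (*-assoc 2 (2 ^ n) _)))
... | inj₂ f₁≤f₀ = outside ∷ T₀ ,
  ≤-trans (m+n≤2*o Σ₀≤ (≤-trans Σ₁≤ (*-monoʳ-≤ (2 ^ n) f₁≤f₀)))
          (≤-reflexive (sym (*-assoc 2 (2 ^ n) _)))

#meets : ∀ {n} → Subset n → ℕ → ℕ
#meets {n} A j = Σ-subsets n (λ T → 𝟙 (does (∣ A ∩ T ∣ ≟ j)))

#meets*2^∣A∣≡∣A∣Cj*2^n : ∀ {n} (A : Subset n) j → #meets A j * 2 ^ ∣ A ∣ ≡ (∣ A ∣ C j) * 2 ^ n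
#meets*2^∣A∣≡∣A∣Cj*2^n []            zero    = refl
#meets*2^∣A∣≡∣A∣Cj*2^n []            (suc j) = refl
#meets*2^∣A∣≡∣A∣Cj*2^n {suc n} (outside ∷ A) j = begin
  (#meets A j + #meets A j) * 2 ^ ∣ A ∣           ≡⟨ *-distribʳ-+ (2 ^ ∣ A ∣) (#meets A j) _ ⟩
  #meets A j * 2 ^ ∣ A ∣ + #meets A j * 2 ^ ∣ A ∣ ≡⟨ cong₂ _+_ ih ih ⟩
  (∣ A ∣ C j) * 2 ^ n + (∣ A ∣ C j) * 2 ^ n       ≡⟨ x*y+x*y≡x*[2*y] (∣ A ∣ C j) (2 ^ n) ⟩
  (∣ A ∣ C j) * (2 * 2 ^ n)                       ∎
  where
  open ≡-Reasoning
  ih = #meets*2^∣A∣≡∣A∣Cj*2^n A j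
  x*y+x*y≡x*[2*y] : ∀ x y → x * y + x * y ≡ x * (2 * y)
  x*y+x*y≡x*[2*y] = solve-∀
#meets*2^∣A∣≡∣A∣Cj*2^n {suc n} (inside ∷ A) zero = begin
  (#meets A 0 + Σ-subsets n (λ _ → 0)) * (2 * 2 ^ ∣ A ∣)
    ≡⟨ cong (λ z → (#meets A 0 + z) * (2 * 2 ^ ∣ A ∣)) (Σ-subsets-0 n) ⟩
  (#meets A 0 + 0) * (2 * 2 ^ ∣ A ∣)                     ≡⟨ [x+0]*[2*y]≡2*[x*y] (#meets A 0) (2 ^ ∣ A ∣) ⟩
  2 * (#meets A 0 * 2 ^ ∣ A ∣)                           ≡⟨ cong (2 *_) (#meets*2^∣A∣≡∣A∣Cj*2^n A 0) ⟩
  2 * (1 * 2 ^ n)                                        ≡⟨ 2*[1*y]≡1*[2*y] (2 ^ n) ⟩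
  1 * (2 * 2 ^ n)                                        ∎
  where
  open ≡-Reasoning
  [x+0]*[2*y]≡2*[x*y] : ∀ x y → (x + 0) * (2 * y) ≡ 2 * (x * y)
  [x+0]*[2*y]≡2*[x*y] = solve-∀
  2*[1*y]≡1*[2*y] : ∀ y → 2 * (1 * y) ≡ 1 * (2 * y)
  2*[1*y]≡1*[2*y] = solve-∀
#meets*2^∣A∣≡∣A∣Cj*2^n {suc n} (inside ∷ A) (suc j) = begin
  (#meets A (suc j) + #meets A j) * (2 * 2 ^ ∣ A ∣)
    ≡⟨ distrib (#meets A (suc j)) (#meets A j) (2 ^ ∣ A ∣) ⟩
  2 * (#meets A (suc j) * 2 ^ ∣ A ∣) + 2 * (#meets A j * 2 ^ ∣ A ∣)
    ≡⟨ cong₂ (λ x y → 2 * x + 2 * y) (#meets*2^∣A∣≡∣A∣Cj*2^n A (suc j)) (#meets*2^∣A∣≡∣A∣Cj*2^n A j) ⟩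
  2 * ((∣ A ∣ C suc j) * 2 ^ n) + 2 * ((∣ A ∣ C j) * 2 ^ n)
    ≡⟨ collect (∣ A ∣ C suc j) (∣ A ∣ C j) (2 ^ n) ⟩
  (∣ A ∣ C j + ∣ A ∣ C suc j) * (2 * 2 ^ n)
    ≡⟨ cong (_* (2 * 2 ^ n)) (nCk+nC[k+1]≡[n+1]C[k+1] ∣ A ∣ j) ⟩
  (suc ∣ A ∣ C suc j) * (2 * 2 ^ n)
    ∎
  where
  open ≡-Reasoning
  distrib : ∀ x y z → (x + y) * (2 * z) ≡ 2 * (x * z) + 2 * (y * z)
  distrib = solve-∀
  collect : ∀ x y z → 2 * (x * z) + 2 * (y * z) ≡ (y + x) * (2 * z)
  collect = solve-∀

k*2^n≤2^k*#meets-once : ∀ {n} k (A : Subset n) → Nonempty A → ∣ A ∣ ≤ k → k * 2 ^ n ≤ 2 ^ k * #meets A 1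
k*2^n≤2^k*#meets-once {n} k A (_ , x∈A) ∣A∣≤k = *-cancelʳ-≤ _ _ (2 ^ ∣ A ∣) {{m^n≢0 2 ∣ A ∣}} (begin
  k * 2 ^ n * 2 ^ ∣ A ∣            ≡⟨ x*y*z≡x*z*y k (2 ^ n) (2 ^ ∣ A ∣) ⟩
  k * 2 ^ ∣ A ∣ * 2 ^ n            ≤⟨ *-monoˡ-≤ (2 ^ n) (k*2^j≤j*2^k k 1≤∣A∣ ∣A∣≤k) ⟩
  ∣ A ∣ * 2 ^ k * 2 ^ n            ≡⟨ x*y*z≡y*[x*z] ∣ A ∣ (2 ^ k) (2 ^ n) ⟩
  2 ^ k * (∣ A ∣ * 2 ^ n)          ≡⟨ cong (λ c → 2 ^ k * (c * 2 ^ n)) (nC1≡n ∣ A ∣) ⟨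
  2 ^ k * ((∣ A ∣ C 1) * 2 ^ n)    ≡⟨ cong (2 ^ k *_) (#meets*2^∣A∣≡∣A∣Cj*2^n A 1) ⟨
  2 ^ k * (#meets A 1 * 2 ^ ∣ A ∣) ≡⟨ *-assoc (2 ^ k) (#meets A 1) (2 ^ ∣ A ∣) ⟨
  2 ^ k * #meets A 1 * 2 ^ ∣ A ∣   ∎)
  where
  open ≤-Reasoning
  1≤∣A∣ : 1 ≤ ∣ A ∣
  1≤∣A∣ = ≤-trans (s≤s z≤n) (x∈p⇒∣p-x∣<∣p∣ x∈A)
  x*y*z≡x*z*y : ∀ x y z → x * y * z ≡ x * z * y
  x*y*z≡x*z*y = solve-∀
  x*y*z≡y*[x*z] : ∀ x y z → x * y * z ≡ y * (x * z)
  x*y*z≡y*[x*z] = solve-∀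

meetsOnce? : ∀ {n} (S' : Subset n) → Decidable (λ e → ∣ e ∩ S' ∣ ≡ 1)
meetsOnce? S' e = ∣ e ∩ S' ∣ ≟ 1

crossCutPart : ∀ {k n} → KGraph k n → Subset n → KGraph k n
crossCutPart H S' = record
  { edges   = filter (meetsOnce? S') (edges H)
  ; unique  = Unique.filter⁺ (meetsOnce? S') (unique H)
  ; uniform = All.filter⁺ (meetsOnce? S') (uniform H)
  }

crossCutPart-⊆ᴴ : ∀ {k n} (H : KGraph k n) S' → crossCutPart H S' ⊆ᴴ H
crossCutPart-⊆ᴴ H S' = proj₁ ∘ ∈-filter⁻ (meetsOnce? S')

crossCutPart-isCrossCut : ∀ {k n} (H : KGraph k n) S' → IsCrossCut (crossCutPart H S') S'
crossCutPart-isCrossCut H S' = All.all-filter (meetsOnce? S') (edges H)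

module _ {n} (S : Subset n) where

  Σ-meetsOnce : List (Subset n) → ℕ
  Σ-meetsOnce es = Σ-subsets n (λ T → length (filter (meetsOnce? (S ∩ T)) es))

  Σ-meetsOnce-∷ : ∀ e es → Σ-meetsOnce (e ∷ es) ≡ #meets (e ∩ S) 1 + Σ-meetsOnce es
  Σ-meetsOnce-∷ e es = begin
    Σ-meetsOnce (e ∷ es)
      ≡⟨ Σ-subsets-cong n (λ T → length-filter-∷ (meetsOnce? (S ∩ T)) e es) ⟩
    Σ-subsets n (λ T → once (e ∩ (S ∩ T)) + length (filter (meetsOnce? (S ∩ T)) es))
      ≡⟨ Σ-subsets-+ n (λ T → once (e ∩ (S ∩ T))) _ ⟩
    Σ-subsets n (λ T → once (e ∩ (S ∩ T))) + Σ-meetsOnce es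
      ≡⟨ cong (_+ Σ-meetsOnce es) (Σ-subsets-cong n (cong once ∘ ∩-assoc e S)) ⟨
    #meets (e ∩ S) 1 + Σ-meetsOnce es ∎
    where
    open ≡-Reasoning
    once : Subset n → ℕ
    once A = 𝟙 (does (∣ A ∣ ≟ 1))

  k*2^n*length≤2^k*Σ-meetsOnce : ∀ k es → All (λ e → ∣ e ∣ ≡ k) es → All (λ e → Nonempty (e ∩ S)) es →
                                 k * 2 ^ n * length es ≤ 2 ^ k * Σ-meetsOnce es
  k*2^n*length≤2^k*Σ-meetsOnce k [] [] [] = ≤-trans (≤-reflexive (*-zeroʳ (k * 2 ^ n))) z≤n
  k*2^n*length≤2^k*Σ-meetsOnce k (e ∷ es) (∣e∣≡k ∷ uniform) (e∩S≢∅ ∷ cover) = begin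
    k * 2 ^ n * suc (length es)                        ≡⟨ *-suc (k * 2 ^ n) (length es) ⟩
    k * 2 ^ n + k * 2 ^ n * length es
      ≤⟨ +-mono-≤ edge (k*2^n*length≤2^k*Σ-meetsOnce k es uniform cover) ⟩
    2 ^ k * #meets (e ∩ S) 1 + 2 ^ k * Σ-meetsOnce es  ≡⟨ *-distribˡ-+ (2 ^ k) _ _ ⟨
    2 ^ k * (#meets (e ∩ S) 1 + Σ-meetsOnce es)        ≡⟨ cong (2 ^ k *_) (Σ-meetsOnce-∷ e es) ⟨
    2 ^ k * Σ-meetsOnce (e ∷ es)                       ∎
    where
    open ≤-Reasoning
    edge : k * 2 ^ n ≤ 2 ^ k * #meets (e ∩ S) 1
    edge = k*2^n≤2^k*#meets-once k (e ∩ S) e∩S≢∅ (≤-trans (∣p∩q∣≤∣p∣ e S) (≤-reflexive ∣e∣≡k))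

  ∃[T]k*size≤2^k*size-crossCutPart : ∀ {k} (H : KGraph k n) → IsVertexCover H S →
                                     ∃[ T ] k * size H ≤ 2 ^ k * size (crossCutPart H (S ∩ T))
  ∃[T]k*size≤2^k*size-crossCutPart {k} H cover = T , *-cancelʳ-≤ _ _ (2 ^ n) {{m^n≢0 2 n}} (begin
    k * size H * 2 ^ n                          ≡⟨ x*y*z≡x*z*y k (size H) (2 ^ n) ⟩
    k * 2 ^ n * size H                          ≤⟨ k*2^n*length≤2^k*Σ-meetsOnce k (edges H) (uniform H) cover ⟩
    2 ^ k * Σ-meetsOnce (edges H)               ≤⟨ *-monoʳ-≤ (2 ^ k) Σ≤2^n*size ⟩
    2 ^ k * (2 ^ n * size (crossCutPart H S'))  ≡⟨ x*[y*z]≡x*z*y (2 ^ k) (2 ^ n) _ ⟩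
    2 ^ k * size (crossCutPart H S') * 2 ^ n    ∎)
    where
    open ≤-Reasoning
    T,Σ≤2^n*size = Σ-subsets-average n (λ T → size (crossCutPart H (S ∩ T)))
    T = proj₁ T,Σ≤2^n*size
    Σ≤2^n*size = proj₂ T,Σ≤2^n*size
    S' = S ∩ T
    x*y*z≡x*z*y : ∀ x y z → x * y * z ≡ x * z * y
    x*y*z≡x*z*y = solve-∀
    x*[y*z]≡x*z*y : ∀ x y z → x * (y * z) ≡ x * z * y
    x*[y*z]≡x*z*y = solve-∀

lemma3p2 : (k n : ℕ) → 2 ≤ k → (H : KGraph k n) → (S : Subset n) → IsVertexCover H S →
    Σ (KGraph k n) λ H' → Σ (Subset n) λ S' →
      (H' ⊆ᴴ H) × (S' ⊆ S) × (k * size H ≤ 2 ^ k * size H') × IsCrossCut H' S'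
lemma3p2 k n _ H S cover with T , bound ← ∃[T]k*size≤2^k*size-crossCutPart S H cover =
  crossCutPart H (S ∩ T) , S ∩ T , crossCutPart-⊆ᴴ H (S ∩ T) , p∩q⊆p S T , bound ,
  crossCutPart-isCrossCut H (S ∩ T)
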